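{- Let $G$ be a connected graph of diameter $D$ and let $W=\{w_1,\dots,w_k\}\subseteq V(G)$. Then $W$ is a strong resolving set for some graph $H\in\mathcal{U}(G)$ if and only if there is a $W$-resolved embedding $\varphi$ of $G$ in $P_{D+1}^{\boxtimes,k}$ such that $\varphi(G)$ is an isometric subgraph of $P_{D+1}^{\boxtimes,k}$.
   Context: For vertices $u,v,w$ of a connected graph $G$, $w$ strongly resolves $u$ and $v$ if there is a shortest $u$-$w$ path containing $v$ or a shortest $v$-$w$ path containing $u$. A set $W\subseteq V(G)$ is a strong resolving set of $G$ if every pair of vertices of $G$ is strongly resolved by some vertex of $W$. $\mathcal{U}(G)$ denotes the family of graphs having $G$ as a spanning subgraph. $P_n$ denotes the path with vertex set $\{0,1,\dots,n-1\}$, where $i$ and $i+1$ are adjacent. The strong product $G_1\boxtimes\cdots\boxtimes G_k$ has vertex set $V(G_1)\times\cdots\times V(G_k)$, two distinct vertices being adjacent iff in every coordinate they are equal or adjacent; $G^{\boxtimes,k}$ is the strong product of $k$ copies of $G$, so in $P_n^{\boxtimes,k}$, $d(x,y)=\max_i|x_i-y_i|$. An embedding of $G$ in $H$ is an injective map $\varphi:V(G)\to V(H)$ with $xy\in E(G)\Rightarrow\varphi(x)\varphi(y)\in E(H)$; $\varphi(G)$ is the subgraph of $H$ induced by $\varphi(V(G))$. A $W$-resolved embedding of $G$ in $P^{\boxtimes,k}$ is an embedding $\varphi$ such that for every $x\in V(G)$, $\varphi(x)=\big(d_{\varphi(G)}(\varphi(x),\varphi(w_1)),\dots,d_{\varphi(G)}(\varphi(x),\varphi(w_k))\big)$.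 A subgraph $G'$ of $H$ is isometric if $d_{G'}(u,v)=d_H(u,v)$ for all $u,v\in V(G')$. -}

module Defs where

open import Data.Nat using (ℕ; zero; suc; _≤_)
open import Data.Fin using (Fin; toℕ)
open import Data.Vec using (Vec; lookup)
open import Data.List using (List; []; _∷_)
open import Data.List.Membership.Propositional using (_∈_)
open import Data.Product using (Σ; Σ-syntax; ∃; ∃-syntax; _×_; _,_)
open import Data.Sum using (_⊎_)
open import Relation.Nullary using (¬_)
open import Relation.Binary.PropositionalEquality using (_≡_; _≢_)
open import Function.Definitions using (Injective)

module _ {V : Set} (E : V → V → Set) where

  data Walk : V → V → ℕ → Set where
    nil  : ∀ {x} → Walk x x 0
    cons : ∀ {x y z l} → E x y → Walk y z l → Walk x z (suc l)

  vertices : ∀ {x y l} → Walk x y l → List V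
  vertices (nil {x})        = x ∷ []
  vertices (cons {x} e p)   = x ∷ vertices p

  IsShortest : ∀ {x y l} → Walk x y l → Set
  IsShortest {x} {y} {l} p = ∀ l' → Walk x y l' → l ≤ l'

  Dist : V → V → ℕ → Set
  Dist x y d = Walk x y d × (∀ l' → Walk x y l' → d ≤ l')

  Connected : Set
  Connected = ∀ x y → ∃[ l ] Walk x y l

  Diameter : ℕ → Set
  Diameter D = (∀ x y → ∃[ d ] (Dist x y d × d ≤ D))
             × (∃[ x ] ∃[ y ] Dist x y D)

  ShortestPathVia : V → V → V → Set
  ShortestPathVia u w v =
    Σ[ l ∈ ℕ ] Σ[ p ∈ Walk u w l ] (IsShortest p × v ∈ vertices p)

  StronglyResolves : V → V → V → Set
  StronglyResolves w u v = ShortestPathVia u w v ⊎ ShortestPathVia v w u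

  IsStrongResolvingSet : ∀ {k} → (Fin k → V) → Set
  IsStrongResolvingSet {k} W =
    ∀ u v → u ≢ v → ∃[ i ] StronglyResolves (W i) u v

  -- induced subgraph on the image of a map f (pulled back along f;
  -- for injective f this is the induced subgraph on f(U), relabelled)
  induced : {U : Set} → (U → V) → U → U → Set
  induced f x y = E (f x) (f y)

record SimpleGraph (n : ℕ) : Set₁ where
  field
    Adj    : Fin n → Fin n → Set
    sym    : ∀ {x y} → Adj x y → Adj y x
    irrefl : ∀ {x} → ¬ Adj x x
open SimpleGraph public

-- H ∈ 𝒰(G): G is a spanning subgraph of H
IsSpanningSubgraphOf : ∀ {n} → SimpleGraph n → SimpleGraph n → Set
IsSpanningSubgraphOf G H = ∀ {x y} → Adj G x y → Adj H x y

PathAdj : ∀ {m} → Fin m → Fin m → Set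
PathAdj i j = toℕ j ≡ suc (toℕ i) ⊎ toℕ i ≡ suc (toℕ j)

StrongPowerAdj : ∀ m k → Vec (Fin m) k → Vec (Fin m) k → Set
StrongPowerAdj m k u v =
  u ≢ v × (∀ i → lookup u i ≡ lookup v i ⊎ PathAdj (lookup u i) (lookup v i))

IsEmbedding : ∀ {n} m k → SimpleGraph n → (Fin n → Vec (Fin m) k) → Set
IsEmbedding m k G φ =
  Injective _≡_ _≡_ φ × (∀ {x y} → Adj G x y → StrongPowerAdj m k (φ x) (φ y))

IsWResolved : ∀ {n} m k → (Fin k → Fin n) → (Fin n → Vec (Fin m) k) → Set
IsWResolved m k W φ =
  ∀ x i → Dist (induced (StrongPowerAdj m k) φ) x (W i) (toℕ (lookup (φ x) i))

IsIsometric : ∀ {n} m k → (Fin n → Vec (Fin m) k) → Set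
IsIsometric m k φ =
  ∀ x y d → (Dist (induced (StrongPowerAdj m k) φ) x y d → Dist (StrongPowerAdj m k) (φ x) (φ y) d)
          × (Dist (StrongPowerAdj m k) (φ x) (φ y) d → Dist (induced (StrongPowerAdj m k) φ) x y d)

-- Two metric facts carry the proof.
--   (1) In a symmetric graph, w strongly resolves u and v iff
--       ∣ d(u,w) - d(v,w) ∣ = d(u,v): shortest paths through v are exactly
--       the equality cases of the triangle inequality.
--   (2) In P_m^{⊠,k} the distance is the Chebyshev distance max_i ∣ u_i - v_i ∣:
--       a step moves each coordinate by at most one, and a greedy walk moving
--       every coordinate towards the target realises the bound.
-- (⇒) φ(x) = (d_H(x,w_i))_i.  All gaps are ≤ d_H(x,y) (triangle inequality) and
--     one equals it by (1), so φ is an isometry by (2); everything follows.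
-- (⇐) H = the induced subgraph φ(G).  For u ≠ v some gap equals d(φu,φv) =
--     d_H(u,v) by (2) and isometry; W-resolvedness makes the coordinates the
--     distances to w_i, so w_i resolves u, v by (1).
module Submission where

open import Defs hiding (sym)
open import Data.Nat using (ℕ; zero; suc; pred; _+_; _≤_; _<_; z≤n; s≤s; ∣_-_∣)
open import Data.Nat.Properties
open import Data.Fin using (Fin; toℕ; fromℕ<) renaming (zero to fzero; suc to fsuc)
open import Data.Fin.Properties using (toℕ-injective; toℕ-fromℕ<; toℕ<n) renaming (_≟_ to _≟ᶠ_)
open import Data.Vec using (Vec; lookup; tabulate)
open import Data.Vec.Properties using (lookup∘tabulate; ≡-dec)
open import Data.Vec.Relation.Binary.Pointwise.Inductive using (Pointwise-≡⇒≡)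
open import Data.Vec.Relation.Binary.Pointwise.Extensional using (ext; extensional⇒inductive)
open import Data.List.Membership.Propositional using (_∈_)
open import Data.List.Relation.Unary.Any using (here; there)
open import Data.Product using (Σ-syntax; ∃-syntax; _×_; _,_; proj₁; proj₂)
open import Data.Sum using (_⊎_; inj₁; inj₂)
import Data.Sum as Sum
open import Data.Empty using (⊥-elim)
open import Relation.Nullary using (Dec; yes; no)
open import Relation.Binary.PropositionalEquality
open import Function.Bundles using (_⇔_; mk⇔)
open import Function.Definitions using (Injective)

mapWalk : ∀ {V U : Set} {E : V → V → Set} {E' : U → U → Set} (f : V → U) →
          (∀ {x y} → E x y → E' (f x) (f y)) →
          ∀ {x y l} → Walk E x y l → Walk E' (f x) (f y) l
mapWalk f hom nil        = nil
mapWalk f hom (cons e p) = cons (hom e) (mapWalk f hom p)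

module Walks {V : Set} (E : V → V → Set) where

  infixr 5 _++ʷ_
  _++ʷ_ : ∀ {x y z a b} → Walk E x y a → Walk E y z b → Walk E x z (a + b)
  nil      ++ʷ q = q
  cons e p ++ʷ q = cons e (p ++ʷ q)

  junction∈ : ∀ {x y z a b} (p : Walk E x y a) (q : Walk E y z b) → y ∈ vertices E (p ++ʷ q)
  junction∈ nil nil          = here refl
  junction∈ nil (cons e q)   = here refl
  junction∈ (cons e p) q     = there (junction∈ p q)

  splitAt : ∀ {u w v l} (p : Walk E u w l) → v ∈ vertices E p →
            Σ[ a ∈ ℕ ] Σ[ b ∈ ℕ ] (Walk E u v a × Walk E v w b × a + b ≡ l)
  splitAt nil (here refl)                = 0 , 0 , nil , nil , refl
  splitAt {l = l} (cons e p) (here refl) = 0 , l , nil , cons e p , refl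
  splitAt (cons e p) (there v∈p)         with splitAt p v∈p
  ... | a , b , p₁ , p₂ , a+b≡l = suc a , b , cons e p₁ , p₂ , cong suc a+b≡l

  dist-refl : ∀ {x} → Dist E x x 0
  dist-refl = nil , λ _ _ → z≤n

  dist-unique : ∀ {x y a b} → Dist E x y a → Dist E x y b → a ≡ b
  dist-unique (p , p-min) (q , q-min) = ≤-antisym (p-min _ q) (q-min _ p)

  dist-zero⇒≡ : ∀ {x y} → Dist E x y 0 → x ≡ y
  dist-zero⇒≡ (nil , _) = refl

  triangle : ∀ {x y z a b c} → Dist E x y a → Dist E y z b → Dist E x z c → c ≤ a + b
  triangle (p , _) (q , _) (_ , r-min) = r-min _ (p ++ʷ q)

  shortestVia⇒additive : ∀ {u w v} → ShortestPathVia E u w v →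
    Σ[ a ∈ ℕ ] Σ[ b ∈ ℕ ] (Dist E u v a × Dist E v w b × Dist E u w (a + b))
  shortestVia⇒additive (l , p , p-min , v∈p) with splitAt p v∈p
  ... | a , b , p₁ , p₂ , refl =
    a , b , (p₁ , λ l' q → +-cancelʳ-≤ b a l' (p-min _ (q ++ʷ p₂)))
          , (p₂ , λ l' q → +-cancelˡ-≤ a b l' (p-min _ (p₁ ++ʷ q)))
          , (p , p-min)

  additive⇒shortestVia : ∀ {u w v a b} → Dist E u v a → Dist E v w b → Dist E u w (a + b) →
                         ShortestPathVia E u w v
  additive⇒shortestVia (p , _) (q , _) (_ , uw-min) = _ , p ++ʷ q , uw-min , junction∈ p q

∣m+n-n∣≡m : ∀ m n → ∣ m + n - n ∣ ≡ m
∣m+n-n∣≡m m n = begin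
  ∣ m + n - n ∣ ≡⟨ ∣-∣-comm (m + n) n ⟩
  ∣ n - m + n ∣ ≡⟨ cong ∣ n -_∣ (+-comm m n) ⟩
  ∣ n - n + m ∣ ≡⟨ ∣m-m+n∣≡n n m ⟩
  m             ∎
  where open ≡-Reasoning

∣n-m+n∣≡m : ∀ m n → ∣ n - m + n ∣ ≡ m
∣n-m+n∣≡m m n = trans (∣-∣-comm n (m + n)) (∣m+n-n∣≡m m n)

gap-cases : ∀ a b → a ≡ b + ∣ a - b ∣ ⊎ b ≡ a + ∣ a - b ∣
gap-cases zero    b       = inj₂ refl
gap-cases (suc a) zero    = inj₁ refl
gap-cases (suc a) (suc b) = Sum.map (cong suc) (cong suc) (gap-cases a b)

gap-≤ : ∀ {a b c} → a ≤ c + b → b ≤ c + a → ∣ a - b ∣ ≤ c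
gap-≤ {a} {b} {c} a≤c+b b≤c+a with gap-cases a b
... | inj₁ a≡b+g = +-cancelˡ-≤ b _ c (subst (_≤ b + c) a≡b+g (subst (a ≤_) (+-comm c b) a≤c+b))
... | inj₂ b≡a+g = +-cancelˡ-≤ a _ c (subst (_≤ a + c) b≡a+g (subst (b ≤_) (+-comm c a) b≤c+a))

Near : ℕ → ℕ → Set
Near a b = a ≡ b ⊎ b ≡ suc a ⊎ a ≡ suc b

∣1+n-n∣≡1 : ∀ n → ∣ suc n - n ∣ ≡ 1
∣1+n-n∣≡1 zero    = refl
∣1+n-n∣≡1 (suc n) = ∣1+n-n∣≡1 n

near⇒gap≤1 : ∀ {a b} → Near a b → ∣ a - b ∣ ≤ 1
near⇒gap≤1 {a} (inj₁ refl)        = ≤-trans (≤-reflexive (∣n-n∣≡0 a)) z≤n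
near⇒gap≤1 {a} (inj₂ (inj₁ refl)) = ≤-reflexive (trans (∣-∣-comm a (suc a)) (∣1+n-n∣≡1 a))
near⇒gap≤1 {b = b} (inj₂ (inj₂ refl)) = ≤-reflexive (∣1+n-n∣≡1 b)

gap≤1⇒near : ∀ a b → ∣ a - b ∣ ≤ 1 → Near a b
gap≤1⇒near zero          zero          _         = inj₁ refl
gap≤1⇒near zero          (suc zero)    _         = inj₂ (inj₁ refl)
gap≤1⇒near zero          (suc (suc b)) (s≤s ())
gap≤1⇒near (suc zero)    zero          _         = inj₂ (inj₂ refl)
gap≤1⇒near (suc (suc a)) zero          (s≤s ())
gap≤1⇒near (suc a)       (suc b)       gap≤1     =
  Sum.map (cong suc) (Sum.map (cong suc) (cong suc)) (gap≤1⇒near a b gap≤1)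

towards : ℕ → ℕ → ℕ
towards zero    zero    = zero
towards zero    (suc b) = 1
towards (suc a) zero    = a
towards (suc a) (suc b) = suc (towards a b)

towards-near : ∀ a b → ∣ a - towards a b ∣ ≤ 1
towards-near zero    zero    = z≤n
towards-near zero    (suc b) = ≤-refl
towards-near (suc a) zero    = ≤-reflexive (∣1+n-n∣≡1 a)
towards-near (suc a) (suc b) = towards-near a b

towards-gap : ∀ a b → ∣ towards a b - b ∣ ≡ pred ∣ a - b ∣
towards-gap zero    zero    = refl
towards-gap zero    (suc b) = refl
towards-gap (suc a) zero    = ∣-∣-identityʳ a
towards-gap (suc a) (suc b) = towards-gap a b

towards-< : ∀ {m} a b → a < m → b < m → towards a b < m
towards-< zero    zero    a<m _   = a<m
towards-< zero    (suc b) _   b<m = ≤-trans (s≤s (s≤s z≤n)) b<m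
towards-< (suc a) zero    a<m _   = <-trans (n<1+n a) a<m
towards-< (suc a) (suc b) (s≤s a<m) (s≤s b<m) = s≤s (towards-< a b a<m b<m)

-- The largest value of a finite family, or 0 for the empty family.
IsMax : ∀ {k} → (Fin k → ℕ) → ℕ → Set
IsMax {k} h c = (∀ i → h i ≤ c) × (c ≡ 0 ⊎ ∃[ i ] h i ≡ c)

max-exists : ∀ {k} (h : Fin k → ℕ) → ∃[ c ] IsMax h c
max-exists {zero}  h = 0 , (λ ()) , inj₁ refl
max-exists {suc k} h with max-exists (λ i → h (fsuc i))
... | c , bounded , attained with ≤-total (h fzero) c
...   | inj₁ h₀≤c = c , bound , Sum.map (λ c≡0 → c≡0) (λ (i , eq) → fsuc i , eq) attained
  where
  bound : ∀ i → h i ≤ c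
  bound fzero    = h₀≤c
  bound (fsuc i) = bounded i
...   | inj₂ c≤h₀ = h fzero , bound , inj₂ (fzero , refl)
  where
  bound : ∀ i → h i ≤ h fzero
  bound fzero    = ≤-refl
  bound (fsuc i) = ≤-trans (bounded i) c≤h₀

IsMax-cong : ∀ {k} {h h' : Fin k → ℕ} {c} → (∀ i → h i ≡ h' i) → IsMax h c → IsMax h' c
IsMax-cong h≗h' (bounded , attained) =
  (λ i → subst (_≤ _) (h≗h' i) (bounded i)) ,
  Sum.map (λ c≡0 → c≡0) (λ (i , eq) → i , trans (sym (h≗h' i)) eq) attained

module StrongPower (m k : ℕ) where

  SP : Vec (Fin m) k → Vec (Fin m) k → Set
  SP = StrongPowerAdj m k

  coord : Vec (Fin m) k → Fin k → ℕ
  coord u i = toℕ (lookup u i)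

  gap : Vec (Fin m) k → Vec (Fin m) k → Fin k → ℕ
  gap u v i = ∣ coord u i - coord v i ∣

  coord-ext : ∀ {u v} → (∀ i → coord u i ≡ coord v i) → u ≡ v
  coord-ext same = Pointwise-≡⇒≡ (extensional⇒inductive (ext λ i → toℕ-injective (same i)))

  SP-gap : ∀ {u v} → SP u v → ∀ i → gap u v i ≤ 1
  SP-gap (_ , adj) i = near⇒gap≤1 (Sum.map₁ (cong toℕ) (adj i))

  SP-intro : ∀ {u v} → u ≢ v → (∀ i → gap u v i ≤ 1) → SP u v
  SP-intro u≢v gap≤1 = u≢v , λ i → Sum.map₁ toℕ-injective (gap≤1⇒near _ _ (gap≤1 i))

  SP-sym : ∀ {u v} → SP u v → SP v u
  SP-sym {u} {v} e = SP-intro (λ v≡u → proj₁ e (sym v≡u))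
    (λ i → subst (_≤ 1) (∣-∣-comm (coord u i) (coord v i)) (SP-gap e i))

  -- Each step of a walk changes every coordinate by at most one.
  walk-gap : ∀ {u v l} → Walk SP u v l → ∀ i → gap u v i ≤ l
  walk-gap {u} nil i = ≤-reflexive (∣n-n∣≡0 (coord u i))
  walk-gap {u} {v} (cons {y = y} e p) i = ≤-trans (∣-∣-triangle (coord u i) (coord y i) (coord v i))
                                            (+-mono-≤ (SP-gap e i) (walk-gap p i))

  stepTowards : Vec (Fin m) k → Vec (Fin m) k → Vec (Fin m) k
  stepTowards u v = tabulate λ i →
    fromℕ< (towards-< (coord u i) (coord v i) (toℕ<n (lookup u i)) (toℕ<n (lookup v i)))

  coord-stepTowards : ∀ u v i → coord (stepTowards u v) i ≡ towards (coord u i) (coord v i)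
  coord-stepTowards u v i = trans (cong toℕ (lookup∘tabulate _ i)) (toℕ-fromℕ< _)

  stepTowards-near : ∀ u v i → gap u (stepTowards u v) i ≤ 1
  stepTowards-near u v i = subst (_≤ 1) (cong ∣ coord u i -_∣ (sym (coord-stepTowards u v i)))
                                 (towards-near (coord u i) (coord v i))

  stepTowards-closer : ∀ {c} u v → (∀ i → gap u v i ≤ suc c) → ∀ i → gap (stepTowards u v) v i ≤ c
  stepTowards-closer {c} u v gap≤c+1 i =
    subst (_≤ c) (sym (trans (cong ∣_- coord v i ∣ (coord-stepTowards u v i))
                             (towards-gap (coord u i) (coord v i))))
          (pred-mono-≤ (gap≤c+1 i))

  greedy-walk : ∀ c u v → (∀ i → gap u v i ≤ c) → Σ[ l ∈ ℕ ] (l ≤ c × Walk SP u v l)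
  greedy-walk zero u v gap≤0 =
    0 , z≤n , subst (λ v' → Walk SP u v' 0) (coord-ext λ i → ∣m-n∣≡0⇒m≡n (n≤0⇒n≡0 (gap≤0 i))) nil
  greedy-walk (suc c) u v gap≤c+1
    with greedy-walk c (stepTowards u v) v (stepTowards-closer u v gap≤c+1)
  ... | l , l≤c , p with ≡-dec _≟ᶠ_ u (stepTowards u v)
  ...   | yes u≡s = l , m≤n⇒m≤1+n l≤c , subst (λ x → Walk SP x v l) (sym u≡s) p
  ...   | no u≢s  = suc l , s≤s l≤c , cons (SP-intro u≢s (stepTowards-near u v)) p

  attained-gap-≤ : ∀ {u v c l} → c ≡ 0 ⊎ ∃[ i ] gap u v i ≡ c → Walk SP u v l → c ≤ l
  attained-gap-≤ (inj₁ refl)    p = z≤n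
  attained-gap-≤ (inj₂ (i , eq)) p = subst (_≤ _) eq (walk-gap p i)

  maxGap⇒dist : ∀ {u v c} → IsMax (gap u v) c → Dist SP u v c
  maxGap⇒dist {u} {v} {c} (bounded , attained) with greedy-walk c u v bounded
  ... | l , l≤c , p = subst (Walk SP u v) (≤-antisym l≤c (attained-gap-≤ attained p)) p
                    , λ l' q → attained-gap-≤ attained q

module SymmetricWalks {V : Set} (E : V → V → Set) (E-sym : ∀ {x y} → E x y → E y x) where
  open Walks E

  reverse : ∀ {x y l} → Walk E x y l → Walk E y x l
  reverse nil                  = nil
  reverse {l = suc l} (cons e p) = subst (Walk E _ _) (+-comm l 1) (reverse p ++ʷ cons (E-sym e) nil)

  dist-sym : ∀ {x y d} → Dist E x y d → Dist E y x d
  dist-sym (p , p-min) = reverse p , λ l' q → p-min l' (reverse q)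

  stronglyResolves⇒gap : ∀ {u v w a b c} → StronglyResolves E w u v →
    Dist E u v c → Dist E u w a → Dist E v w b → ∣ a - b ∣ ≡ c
  stronglyResolves⇒gap (inj₁ via) uv uw vw with shortestVia⇒additive via
  ... | c' , b' , uv' , vw' , uw'
    rewrite dist-unique uw uw' | dist-unique vw vw' | dist-unique uv uv' = ∣m+n-n∣≡m c' b'
  stronglyResolves⇒gap (inj₂ via) uv uw vw with shortestVia⇒additive via
  ... | c' , a' , vu' , uw' , vw'
    rewrite dist-unique uw uw' | dist-unique vw vw' | dist-unique (dist-sym uv) vu' = ∣n-m+n∣≡m c' a'

  gap⇒stronglyResolves : ∀ {u v w a b c} →
    Dist E u v c → Dist E u w a → Dist E v w b → ∣ a - b ∣ ≡ c → StronglyResolves E w u v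
  gap⇒stronglyResolves {a = a} {b} {c} uv uw vw gap≡c with gap-cases a b
  ... | inj₁ a≡b+g = inj₁ (additive⇒shortestVia uv vw
          (subst (Dist E _ _) (trans a≡b+g (trans (+-comm b _) (cong (_+ b) gap≡c))) uw))
  ... | inj₂ b≡a+g = inj₂ (additive⇒shortestVia (dist-sym uv) uw
          (subst (Dist E _ _) (trans b≡a+g (trans (+-comm a _) (cong (_+ a) gap≡c))) vw))

module ProfileEmbedding {n k D} (G : SimpleGraph n) (W : Fin k → Fin n) (diam : Diameter (Adj G) D)
  (H : SimpleGraph n) (G⊆H : IsSpanningSubgraphOf G H) (resolving : IsStrongResolvingSet (Adj H) W) where
  open Walks (Adj H)
  open SymmetricWalks (Adj H) (SimpleGraph.sym H)
  open StrongPower (suc D) k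

  -- Resolvability alone yields all distances: a prefix of a shortest path is shortest.
  distance : ∀ u v → ∃[ d ] Dist (Adj H) u v d
  distance u v with u ≟ᶠ v
  ... | yes refl = 0 , dist-refl
  ... | no u≢v with resolving u v u≢v
  ...   | _ , inj₁ via = let a , _ , uv , _ = shortestVia⇒additive via in a , uv
  ...   | _ , inj₂ via = let a , _ , vu , _ = shortestVia⇒additive via in a , dist-sym vu

  d : Fin n → Fin n → ℕ
  d u v = proj₁ (distance u v)

  d-spec : ∀ u v → Dist (Adj H) u v (d u v)
  d-spec u v = proj₂ (distance u v)

  -- G ⊆ H, so distances in H are bounded by the diameter of G.
  d≤D : ∀ x y → d x y ≤ D
  d≤D x y = let _ , (pG , _) , dG≤D = proj₁ diam x y in
    ≤-trans (proj₂ (d-spec x y) _ (mapWalk (λ z → z) G⊆H pG)) dG≤D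

  -- The profile gaps have maximum d(x,y): triangle inequality plus resolvability.
  profile-maxGap : ∀ x y → IsMax (λ i → ∣ d x (W i) - d y (W i) ∣) (d x y)
  profile-maxGap x y = bounded , attained
    where
    bounded : ∀ i → ∣ d x (W i) - d y (W i) ∣ ≤ d x y
    bounded i = gap-≤ (triangle (d-spec x y) (d-spec y (W i)) (d-spec x (W i)))
                      (triangle (dist-sym (d-spec x y)) (d-spec x (W i)) (d-spec y (W i)))
    attained-by : Dec (x ≡ y) → d x y ≡ 0 ⊎ ∃[ i ] ∣ d x (W i) - d y (W i) ∣ ≡ d x y
    attained-by (yes refl) = inj₁ (dist-unique (d-spec x x) dist-refl)
    attained-by (no x≢y) with resolving x y x≢y
    ... | i , res = inj₂ (i , stronglyResolves⇒gap res (d-spec x y) (d-spec x (W i)) (d-spec y (W i)))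
    attained : d x y ≡ 0 ⊎ ∃[ i ] ∣ d x (W i) - d y (W i) ∣ ≡ d x y
    attained = attained-by (x ≟ᶠ y)

  φ : Fin n → Vec (Fin (suc D)) k
  φ x = tabulate λ i → fromℕ< (s≤s (d≤D x (W i)))

  coord-φ : ∀ x i → coord (φ x) i ≡ d x (W i)
  coord-φ x i = trans (cong toℕ (lookup∘tabulate _ i)) (toℕ-fromℕ< _)

  dist-φ : ∀ x y → Dist SP (φ x) (φ y) (d x y)
  dist-φ x y = maxGap⇒dist (IsMax-cong
    (λ i → sym (cong₂ ∣_-_∣ (coord-φ x i) (coord-φ y i))) (profile-maxGap x y))

  φ-injective : Injective _≡_ _≡_ φ
  φ-injective {x} {y} φx≡φy = dist-zero⇒≡ (subst (Dist (Adj H) x y) d≡0 (d-spec x y))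
    where
    d≡0 : d x y ≡ 0
    d≡0 = Walks.dist-unique SP (subst (λ v → Dist SP (φ x) v (d x y)) (sym φx≡φy) (dist-φ x y)) (Walks.dist-refl SP)

  edge-φ : ∀ {x y} → Adj H x y → SP (φ x) (φ y)
  edge-φ {x} {y} e = SP-intro (λ φx≡φy → SimpleGraph.irrefl H (subst (Adj H x) (sym (φ-injective φx≡φy)) e))
    (λ i → ≤-trans (walk-gap (proj₁ (dist-φ x y)) i) (proj₂ (d-spec x y) 1 (cons e nil)))

  Image : Fin n → Fin n → Set
  Image = induced SP φ

  -- Distances in the image φ(G) agree with d: lower bound via the strong power.
  dist-image : ∀ x y → Dist Image x y (d x y)
  dist-image x y = mapWalk (λ z → z) edge-φ (proj₁ (d-spec x y))
                 , λ l q → proj₂ (dist-φ x y) l (mapWalk φ (λ e → e) q)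

  result : Σ[ φ ∈ (Fin n → Vec (Fin (suc D)) k) ]
             (IsEmbedding (suc D) k G φ × IsWResolved (suc D) k W φ × IsIsometric (suc D) k φ)
  result = φ , (φ-injective , λ e → edge-φ (G⊆H e))
             , (λ x i → subst (Dist Image x (W i)) (sym (coord-φ x i)) (dist-image x (W i)))
             , λ x y c → (λ img → subst (Dist SP (φ x) (φ y)) (Walks.dist-unique Image (dist-image x y) img) (dist-φ x y))
                       , (λ sp → subst (Dist Image x y) (Walks.dist-unique SP (dist-φ x y) sp) (dist-image x y))

module ImageGraph {n k D} (G : SimpleGraph n) (W : Fin k → Fin n)
  (φ : Fin n → Vec (Fin (suc D)) k) (embedding : IsEmbedding (suc D) k G φ)
  (W-resolved : IsWResolved (suc D) k W φ) (isometric : IsIsometric (suc D) k φ) where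
  open StrongPower (suc D) k

  H : SimpleGraph n
  H = record { Adj = induced SP φ ; sym = SP-sym ; irrefl = λ e → proj₁ e refl }

  open Walks (Adj H)
  open SymmetricWalks (Adj H) SP-sym

  -- Some coordinate gap attains d(φu,φv) = d_H(u,v); its index resolves u and v.
  resolving : IsStrongResolvingSet (Adj H) W
  resolving u v u≢v with max-exists (gap (φ u) (φ v))
  ... | c , isMax with proj₂ (isometric u v c) (maxGap⇒dist isMax) | proj₂ isMax
  ...   | uv | inj₁ refl     = ⊥-elim (u≢v (dist-zero⇒≡ uv))
  ...   | uv | inj₂ (i , eq) = i , gap⇒stronglyResolves uv (W-resolved u i) (W-resolved v i) eq

  result : Σ[ H ∈ SimpleGraph n ] (IsSpanningSubgraphOf G H × IsStrongResolvingSet (Adj H) W)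
  result = H , proj₂ embedding , resolving

theorem3p2 : ∀ {n k D} (G : SimpleGraph n) (W : Fin k → Fin n)
    → Connected (Adj G) → Diameter (Adj G) D → Injective _≡_ _≡_ W
    → (Σ[ H ∈ SimpleGraph n ] (IsSpanningSubgraphOf G H × IsStrongResolvingSet (Adj H) W))
      ⇔ (Σ[ φ ∈ (Fin n → Vec (Fin (suc D)) k) ]
           (IsEmbedding (suc D) k G φ × IsWResolved (suc D) k W φ × IsIsometric (suc D) k φ))
theorem3p2 G W _ diam _ = mk⇔
  (λ (H , G⊆H , resolving) → ProfileEmbedding.result G W diam H G⊆H resolving)
  (λ (φ , embedding , W-resolved , isometric) → ImageGraph.result G W φ embedding W-resolved isometric)
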